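{- Let $(G_n)_{n\ge 1}$ be a sequence of finite groups, not necessarily abelian, with $|G_n|\to\infty$. For each $n$ let $S_n$ be a subset of $G_n$ chosen uniformly at random among all $2^{|G_n|}$ subsets of $G_n$. Then \[ \mathbb{P}\big(S_n+S_n \;=\; S_n-S_n \;=\; G_n\big)\longrightarrow 1 \quad\text{as } n\to\infty . \] In particular, the probability that $|S_n+S_n|=|S_n-S_n|$ tends to $1$.
   Context: The group operation is written additively, $+$, but is not assumed commutative; $-y$ denotes the inverse of $y$. For a subset $S$ of a group $G$, the sumset is $S+S=\{x+y : x,y\in S\}$ and the difference set is $S-S=\{x+(-y) : x,y\in S\}$. -}

module Defs where

open import Level using (0ℓ)
open import Data.Bool using (Bool; true; false)
open import Data.Nat using (ℕ; zero; suc; _+_)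
open import Data.Fin using (Fin)
open import Data.Fin.Properties using (any?; all?)
open import Data.Fin.Subset using (Subset; _∈_)
open import Data.Fin.Subset.Properties using (_∈?_)
open import Data.Vec using (_∷_; [])
open import Data.Product using (∃; ∃-syntax; _×_; _,_)
open import Data.Product.Properties using ()
open import Relation.Nullary using (Dec; does; yes; no)
open import Relation.Nullary.Decidable using (_×-dec_)
open import Relation.Binary.PropositionalEquality using (_≡_)
open import Algebra.Structures using (IsGroup)

-- A finite group of order m, represented (up to isomorphism, as every finite
-- group is) by a group structure on the carrier Fin m.  The group law is
-- written additively but is NOT assumed commutative.
record FinGroup (m : ℕ) : Set where
  field
    _+ᴳ_    : Fin m → Fin m → Fin m
    0ᴳ      : Fin m
    -ᴳ_     : Fin m → Fin m
    isGroup : IsGroup {A = Fin m} _≡_ _+ᴳ_ 0ᴳ -ᴳ_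

_∈SumSet_ : ∀ {m} → Fin m → (FinGroup m × Subset m) → Set
g ∈SumSet (G , S) = ∃[ x ] ∃[ y ] (x ∈ S × y ∈ S × g ≡ x +ᴳ y)
  where open FinGroup G

_∈DiffSet_ : ∀ {m} → Fin m → (FinGroup m × Subset m) → Set
g ∈DiffSet (G , S) = ∃[ x ] ∃[ y ] (x ∈ S × y ∈ S × g ≡ x +ᴳ (-ᴳ y))
  where open FinGroup G

Event : ∀ {m} → FinGroup m → Subset m → Set
Event G S = (∀ g → g ∈SumSet (G , S)) × (∀ g → g ∈DiffSet (G , S))

Event? : ∀ {m} (G : FinGroup m) (S : Subset m) → Dec (Event G S)
Event? G S =
  all? (λ g → any? (λ x → any? (λ y → (x ∈? S) ×-dec ((y ∈? S) ×-dec (g Data.Fin.≟ (x +ᴳ y))))))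
  ×-dec
  all? (λ g → any? (λ x → any? (λ y → (x ∈? S) ×-dec ((y ∈? S) ×-dec (g Data.Fin.≟ (x +ᴳ (-ᴳ y)))))))
  where open FinGroup G

countSubsets : (m : ℕ) → (Subset m → Bool) → ℕ
countSubsets zero    p = if-true (p [])
  where
    if-true : Bool → ℕ
    if-true true  = 1
    if-true false = 0
countSubsets (suc m) p =
  countSubsets m (λ S → p (true ∷ S)) + countSubsets m (λ S → p (false ∷ S))

badCount : ∀ {m} → FinGroup m → ℕ
badCount {m} G = countSubsets m (λ S → notB (does (Event? G S)))
  where
    notB : Bool → Bool
    notB true  = false
    notB false = true

-- Fix g.  Its representations g = x + y are the pairs (g − x , x), and x ↦ g − x is a bijection,
-- so greedily one finds ⌊|G|/3⌋ such pairs that are pairwise disjoint.  For disjoint pairs the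
-- events "S contains both points" are independent of probability 1/4 (flipping a coordinate that
-- the remaining constraints ignore is a bijection on subsets), hence g ∉ S + S for at most
-- (3/4)^⌊|G|/3⌋ · 2^|G| subsets S; likewise g ∉ S − S, using the pairs (g + x , x).  A union bound
-- over these 2|G| events leaves 2|G| (3/4)^⌊|G|/3⌋ · 2^|G| bad subsets, eventually below 2^|G|/(k+1).

module Submission where

open import Defs
open import Data.Nat using (ℕ; suc; _*_; _^_; _≤_)
open import Data.Product using (∃-syntax)

open import Algebra.Bundles using (Group)
import Algebra.Properties.Group as GroupProperties
open import Algebra.Structures using (IsGroup)
open import Data.Bool using (Bool; true; false; not; _∧_; _∨_)
open import Data.Bool.ListAction using (all; any)
open import Data.Bool.Properties using (∧-idem; ∧-assoc; ∧-conicalˡ; ∧-conicalʳ; ∨-conicalˡ; ∨-conicalʳ)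
open import Data.Fin using (Fin; zero; suc; _≟_)
open import Data.Fin.Subset using (Subset; _∈_; _∉_; _-_; ∣_∣; ⊤; ⁅_⁆)
open import Data.Fin.Subset.Properties
  using (nonempty?; Empty-unique; drop-there; p─⊥≡p; p─q⊆p; ∣⊥∣≡0; ∣⊤∣≡n; ∣p─q∣≤∣p∣; x∈p⇒∣p-x∣<∣p∣)
open import Data.List using (List; []; _∷_; map; length; allFin)
open import Data.List.Membership.Propositional using () renaming (_∈_ to _∈ₗ_)
open import Data.List.Membership.Propositional.Properties using (∈-allFin)
open import Data.List.Properties using (length-map; length-tabulate)
open import Data.List.Relation.Unary.All using (All; []; _∷_)
import Data.List.Relation.Unary.All as All
open import Data.List.Relation.Unary.AllPairs using (AllPairs; []; _∷_)
import Data.List.Relation.Unary.AllPairs.Properties as AllPairs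
open import Data.List.Relation.Unary.Any using (here; there)
open import Data.Nat using (zero; _+_; _<_; z≤n; s≤s; s≤s⁻¹; _≤′_; ≤′-refl; ≤′-step)
open import Data.Nat.DivMod using (_/_; m≡m%n+[m/n]*n; m%n<n; m/n*n≤m; m*n/n≡m; /-monoˡ-≤)
open import Data.Nat.Properties
  using ( ≤-refl; ≤-reflexive; ≤-trans; ≤-<-trans; <-≤-trans; <⇒≤; n≤1+n; m≤n⇒m≤1+n; m≤m+n
        ; ≤ᵇ⇒≤; ≤⇒≤′; ≤′⇒≤; +-comm; +-identityʳ; +-mono-≤; +-monoʳ-≤; +-monoˡ-<; +-cancelʳ-≤
        ; *-comm; *-assoc; *-identityˡ; *-identityʳ; *-distribˡ-+; *-distribʳ-+; *-mono-≤
        ; *-monoˡ-≤; *-monoʳ-≤; *-cancelˡ-≤; *-cancelʳ-≤; ^-distribˡ-+-*; m^n≢0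
        ; +-commutativeSemigroup; module ≤-Reasoning )
open import Data.Nat.Tactic.RingSolver using (solve-∀)
open import Data.Product using (_×_; _,_; proj₁; proj₂; <_,_>)
open import Data.Vec using ([]; _∷_; lookup; _[_]%=_)
open import Data.Vec.Properties using (lookup∘updateAt; lookup∘updateAt′; lookup⇒[]=)
open import Function using (id; _∘_; _on_)
open import Level using (0ℓ)
open import Relation.Binary.PropositionalEquality
  using (_≡_; _≢_; ≢-sym; refl; sym; trans; cong; cong₂; subst; module ≡-Reasoning)
open import Relation.Nullary using (yes; no; does)
open import Relation.Nullary.Decidable using (dec-true)

open import Algebra.Properties.CommutativeSemigroup +-commutativeSemigroup using (interchange)

countSubsets-cong : ∀ {m} {p q : Subset m → Bool} →
                    (∀ S → p S ≡ q S) → countSubsets m p ≡ countSubsets m q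
countSubsets-cong {zero}  p≗q rewrite p≗q [] = refl
countSubsets-cong {suc m} p≗q =
  cong₂ _+_ (countSubsets-cong (p≗q ∘ (true ∷_))) (countSubsets-cong (p≗q ∘ (false ∷_)))

countSubsets-mono : ∀ {m} {p q : Subset m → Bool} →
                    (∀ S → p S ≡ true → q S ≡ true) → countSubsets m p ≤ countSubsets m q
countSubsets-mono {zero} {p} {q} p⇒q with p [] | q [] | p⇒q []
... | false | _     | _   = z≤n
... | true  | true  | _   = ≤-refl
... | true  | false | p⇒q′ with () ← p⇒q′ refl
countSubsets-mono {suc m} p⇒q =
  +-mono-≤ (countSubsets-mono (p⇒q ∘ (true ∷_))) (countSubsets-mono (p⇒q ∘ (false ∷_)))

countSubsets-≤ : ∀ {m} (p : Subset m → Bool) → countSubsets m p ≤ 2 ^ m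
countSubsets-≤ {zero} p with p []
... | true  = ≤-refl
... | false = z≤n
countSubsets-≤ {suc m} p =
  +-mono-≤ (countSubsets-≤ (p ∘ (true ∷_)))
           (≤-trans (countSubsets-≤ (p ∘ (false ∷_))) (≤-reflexive (sym (+-identityʳ (2 ^ m)))))

countSubsets-false : ∀ m → countSubsets m (λ _ → false) ≡ 0
countSubsets-false zero    = refl
countSubsets-false (suc m) = cong₂ _+_ (countSubsets-false m) (countSubsets-false m)

countSubsets-partition : ∀ {m} (r p : Subset m → Bool) →
  countSubsets m p ≡ countSubsets m (λ S → r S ∧ p S) + countSubsets m (λ S → not (r S) ∧ p S)
countSubsets-partition {zero} r p with r [] | p []
... | true  | true  = refl
... | true  | false = refl
... | false | true  = refl
... | false | false = refl
countSubsets-partition {suc m} r p =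
  trans (cong₂ _+_ (countSubsets-partition (r ∘ (true ∷_)) (p ∘ (true ∷_)))
                   (countSubsets-partition (r ∘ (false ∷_)) (p ∘ (false ∷_))))
        (interchange (countSubsets m (λ S → r (true ∷ S) ∧ p (true ∷ S)))
                     (countSubsets m (λ S → not (r (true ∷ S)) ∧ p (true ∷ S)))
                     (countSubsets m (λ S → r (false ∷ S) ∧ p (false ∷ S)))
                     (countSubsets m (λ S → not (r (false ∷ S)) ∧ p (false ∷ S))))

countSubsets-∨ : ∀ {m} (p q : Subset m → Bool) →
                 countSubsets m (λ S → p S ∨ q S) ≤ countSubsets m p + countSubsets m q
countSubsets-∨ {zero} p q with p [] | q []
... | true  | true  = s≤s z≤n
... | true  | false = ≤-refl
... | false | true  = ≤-refl
... | false | false = ≤-refl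
countSubsets-∨ {suc m} p q =
  ≤-trans (+-mono-≤ (countSubsets-∨ (p ∘ (true ∷_)) (q ∘ (true ∷_)))
                    (countSubsets-∨ (p ∘ (false ∷_)) (q ∘ (false ∷_))))
          (≤-reflexive (interchange (countSubsets m (p ∘ (true ∷_))) (countSubsets m (q ∘ (true ∷_)))
                                    (countSubsets m (p ∘ (false ∷_))) (countSubsets m (q ∘ (false ∷_)))))

countSubsets-any : ∀ {m} {A : Set} (P : A → Subset m → Bool) (xs : List A) {F B : ℕ} →
  (∀ x → countSubsets m (P x) * F ≤ B) →
  countSubsets m (λ S → any (λ x → P x S) xs) * F ≤ length xs * B
countSubsets-any {m} P [] {F} _ = ≤-reflexive (cong (_* F) (countSubsets-false m))
countSubsets-any {m} P (x ∷ xs) {F} {B} bound = begin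
  countSubsets m (λ S → P x S ∨ any (λ y → P y S) xs) * F
    ≤⟨ *-monoˡ-≤ F (countSubsets-∨ (P x) (λ S → any (λ y → P y S) xs)) ⟩
  (countSubsets m (P x) + countSubsets m (λ S → any (λ y → P y S) xs)) * F
    ≡⟨ *-distribʳ-+ F (countSubsets m (P x)) _ ⟩
  countSubsets m (P x) * F + countSubsets m (λ S → any (λ y → P y S) xs) * F
    ≤⟨ +-mono-≤ (bound x) (countSubsets-any P xs bound) ⟩
  B + length xs * B ∎
  where open ≤-Reasoning

countSubsets-flip : ∀ {m} (i : Fin m) (p : Subset m → Bool) →
                    countSubsets m (λ S → p (S [ i ]%= not)) ≡ countSubsets m p
countSubsets-flip {suc m} zero    p = +-comm (countSubsets m (p ∘ (false ∷_))) _
countSubsets-flip {suc m} (suc i) p =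
  cong₂ _+_ (countSubsets-flip i (p ∘ (true ∷_))) (countSubsets-flip i (p ∘ (false ∷_)))

Ignores : ∀ {m} → Fin m → (Subset m → Bool) → Set
Ignores i p = ∀ S → p (S [ i ]%= not) ≡ p S

bothIn : ∀ {m} → Subset m → Fin m × Fin m → Bool
bothIn S (a , b) = lookup S a ∧ lookup S b

countSubsets-halve : ∀ {m} (i : Fin m) (p : Subset m → Bool) → Ignores i p →
                     countSubsets m p ≡ 2 * countSubsets m (λ S → lookup S i ∧ p S)
countSubsets-halve {m} i p i-free = begin
  countSubsets m p                                        ≡⟨ countSubsets-partition (λ S → lookup S i) p ⟩
  In + countSubsets m (λ S → not (lookup S i) ∧ p S)      ≡⟨ cong (In +_) out≡in ⟩
  In + In                                                 ≡⟨ cong (In +_) (sym (+-identityʳ In)) ⟩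
  2 * In                                                  ∎
  where
  open ≡-Reasoning
  In = countSubsets m (λ S → lookup S i ∧ p S)
  out≡in : countSubsets m (λ S → not (lookup S i) ∧ p S) ≡ In
  out≡in = trans (countSubsets-cong (λ S → cong₂ _∧_ (sym (lookup∘updateAt i S)) (sym (i-free S))))
                 (countSubsets-flip i (λ S → lookup S i ∧ p S))

countSubsets-quarter : ∀ {m} (a b : Fin m) (p : Subset m → Bool) → Ignores a p → Ignores b p →
                       countSubsets m p ≤ 4 * countSubsets m (λ S → bothIn S (a , b) ∧ p S)
countSubsets-quarter {m} a b p a-free b-free with a ≟ b
... | yes refl = begin
  countSubsets m p                                    ≡⟨ countSubsets-halve a p a-free ⟩
  2 * A                                               ≤⟨ *-monoˡ-≤ A (m≤m+n 2 2) ⟩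
  4 * A                                               ≡⟨ cong (4 *_) (countSubsets-cong λ S →
                                                           cong (_∧ p S) (sym (∧-idem (lookup S a)))) ⟩
  4 * countSubsets m (λ S → bothIn S (a , a) ∧ p S)   ∎
  where
  open ≤-Reasoning
  A = countSubsets m (λ S → lookup S a ∧ p S)
... | no a≢b = ≤-reflexive (begin
  countSubsets m p                                    ≡⟨ countSubsets-halve b p b-free ⟩
  2 * countSubsets m (λ S → lookup S b ∧ p S)         ≡⟨ cong (2 *_) (countSubsets-halve a _ a-free′) ⟩
  2 * (2 * AB)                                        ≡⟨ sym (*-assoc 2 2 AB) ⟩
  4 * AB                                              ≡⟨ cong (4 *_) (countSubsets-cong λ S →
                                                           sym (∧-assoc (lookup S a) (lookup S b) (p S))) ⟩
  4 * countSubsets m (λ S → bothIn S (a , b) ∧ p S)   ∎)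
  where
  open ≡-Reasoning
  AB = countSubsets m (λ S → lookup S a ∧ (lookup S b ∧ p S))
  a-free′ : Ignores a (λ S → lookup S b ∧ p S)
  a-free′ S = cong₂ _∧_ (lookup∘updateAt′ b a (≢-sym a≢b) S) (a-free S)

countSubsets-notBoth : ∀ {m} (a b : Fin m) (p : Subset m → Bool) → Ignores a p → Ignores b p →
                       4 * countSubsets m (λ S → not (bothIn S (a , b)) ∧ p S) ≤ 3 * countSubsets m p
countSubsets-notBoth {m} a b p a-free b-free = +-cancelʳ-≤ N (4 * Y) (3 * N) (begin
  4 * Y + N      ≤⟨ +-monoʳ-≤ (4 * Y) (countSubsets-quarter a b p a-free b-free) ⟩
  4 * Y + 4 * X  ≡⟨ sym (*-distribˡ-+ 4 Y X) ⟩
  4 * (Y + X)    ≡⟨ cong (4 *_) (trans (+-comm Y X) (sym split)) ⟩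
  4 * N          ≡⟨ +-comm N (3 * N) ⟩
  3 * N + N      ∎)
  where
  open ≤-Reasoning
  N = countSubsets m p
  X = countSubsets m (λ S → bothIn S (a , b) ∧ p S)
  Y = countSubsets m (λ S → not (bothIn S (a , b)) ∧ p S)
  split : N ≡ X + Y
  split = countSubsets-partition (λ S → bothIn S (a , b)) p

Avoids : ∀ {m} → Fin m → Fin m × Fin m → Set
Avoids i (c , d) = i ≢ c × i ≢ d

Disjoint : ∀ {m} → Fin m × Fin m → Fin m × Fin m → Set
Disjoint (a , b) cd = Avoids a cd × Avoids b cd

pairFree : ∀ {m} → List (Fin m × Fin m) → Subset m → Bool
pairFree L S = all (not ∘ bothIn S) L

pairFree-ignores : ∀ {m} {i : Fin m} {L} → All (Avoids i) L → Ignores i (pairFree L)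
pairFree-ignores [] S = refl
pairFree-ignores {i = i} {(c , d) ∷ L} ((i≢c , i≢d) ∷ avoids) S =
  cong₂ _∧_ (cong not (cong₂ _∧_ (lookup∘updateAt′ c i (≢-sym i≢c) S)
                                  (lookup∘updateAt′ d i (≢-sym i≢d) S)))
            (pairFree-ignores avoids S)

countSubsets-pairFree : ∀ {m} t (L : List (Fin m × Fin m)) → AllPairs Disjoint L → t ≤ length L →
                        countSubsets m (pairFree L) * 4 ^ t ≤ 3 ^ t * 2 ^ m
countSubsets-pairFree {m} zero L _ _ = begin
  countSubsets m (pairFree L) * 1  ≡⟨ *-identityʳ _ ⟩
  countSubsets m (pairFree L)      ≤⟨ countSubsets-≤ (pairFree L) ⟩
  2 ^ m                            ≡⟨ sym (+-identityʳ _) ⟩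
  1 * 2 ^ m                        ∎
  where open ≤-Reasoning
countSubsets-pairFree {m} (suc t) ((a , b) ∷ L) (disjoint ∷ disjoint-rest) (s≤s t≤∣L∣) = begin
  C * (4 * 4 ^ t)                         ≡⟨ sym (*-assoc C 4 (4 ^ t)) ⟩
  C * 4 * 4 ^ t                           ≡⟨ cong (_* 4 ^ t) (*-comm C 4) ⟩
  4 * C * 4 ^ t                           ≤⟨ *-monoˡ-≤ (4 ^ t) (countSubsets-notBoth a b (pairFree L)
                                               (pairFree-ignores (All.map proj₁ disjoint))
                                               (pairFree-ignores (All.map proj₂ disjoint))) ⟩
  3 * countSubsets m (pairFree L) * 4 ^ t  ≡⟨ *-assoc 3 (countSubsets m (pairFree L)) (4 ^ t) ⟩
  3 * (countSubsets m (pairFree L) * 4 ^ t) ≤⟨ *-monoʳ-≤ 3 (countSubsets-pairFree t L disjoint-rest t≤∣L∣) ⟩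
  3 * (3 ^ t * 2 ^ m)                     ≡⟨ sym (*-assoc 3 (3 ^ t) (2 ^ m)) ⟩
  3 * 3 ^ t * 2 ^ m                       ∎
  where
  open ≤-Reasoning
  C = countSubsets m (pairFree ((a , b) ∷ L))

x∉p-x : ∀ {n} (p : Subset n) x → x ∉ p - x
x∉p-x (s ∷ p) zero    ()
x∉p-x (s ∷ p) (suc x) x∈ = x∉p-x p x (drop-there x∈)

∈p-x⇒∈p×≢x : ∀ {n} {p : Subset n} {x y} → y ∈ p - x → y ∈ p × y ≢ x
∈p-x⇒∈p×≢x {p = p} {x} y∈ = p─q⊆p p ⁅ x ⁆ y∈ , λ { refl → x∉p-x p x y∈ }

∣p∣≤1+∣p-x∣ : ∀ {n} (p : Subset n) x → ∣ p ∣ ≤ suc ∣ p - x ∣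
∣p∣≤1+∣p-x∣ (true  ∷ p) zero    = s≤s (≤-reflexive (cong ∣_∣ (sym (p─⊥≡p p))))
∣p∣≤1+∣p-x∣ (false ∷ p) zero    = ≤-trans (n≤1+n ∣ p ∣) (s≤s (≤-reflexive (cong ∣_∣ (sym (p─⊥≡p p)))))
∣p∣≤1+∣p-x∣ (true  ∷ p) (suc x) = s≤s (∣p∣≤1+∣p-x∣ p x)
∣p∣≤1+∣p-x∣ (false ∷ p) (suc x) = ∣p∣≤1+∣p-x∣ p x

module GraphMatching {m} (f h : Fin m → Fin m) (h∘f : ∀ x → h (f x) ≡ x) where

  -- Picking x from the available set p retires x, its partner f x and its preimage h x, so every
  -- later pair (f y , y) is disjoint from (f x , x).
  matching : ℕ → Subset m → List (Fin m)
  matching zero    p = []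
  matching (suc n) p with nonempty? p
  ... | yes (x , _) = x ∷ matching n (p - x - f x - h x)
  ... | no _        = []

  private
    retired : ∀ {p x y} → y ∈ p - x - f x - h x → y ∈ p × y ≢ x × y ≢ f x × y ≢ h x
    retired y∈ with ∈p-x⇒∈p×≢x y∈
    ... | y∈₁ , y≢hx with ∈p-x⇒∈p×≢x y∈₁
    ... | y∈₂ , y≢fx with ∈p-x⇒∈p×≢x y∈₂
    ... | y∈p , y≢x = y∈p , y≢x , y≢fx , y≢hx

  matching⊆ : ∀ n p → All (_∈ p) (matching n p)
  matching⊆ zero    p = []
  matching⊆ (suc n) p with nonempty? p
  ... | yes (x , x∈p) = x∈p ∷ All.map (proj₁ ∘ retired) (matching⊆ n _)
  ... | no _          = []

  matching-disjoint : ∀ n p → AllPairs (Disjoint on < f , id >) (matching n p)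
  matching-disjoint zero    p = []
  matching-disjoint (suc n) p with nonempty? p
  ... | yes (x , _) = All.map separated (matching⊆ n _) ∷ matching-disjoint n _
    where
    separated : ∀ {y} → y ∈ p - x - f x - h x → Disjoint (f x , x) (f y , y)
    separated {y} y∈ with retired y∈
    ... | _ , y≢x , y≢fx , y≢hx =
      ( (λ fx≡fy → y≢x (trans (sym (h∘f y)) (trans (cong h (sym fx≡fy)) (h∘f x))))
      , ≢-sym y≢fx )
      , ( (λ x≡fy → y≢hx (trans (sym (h∘f y)) (cong h (sym x≡fy))))
        , ≢-sym y≢x )
  ... | no _        = []

  matching-large : ∀ n p → ∣ p ∣ ≤ n → ∣ p ∣ ≤ length (matching n p) * 3
  matching-large zero    p ∣p∣≤0 = ∣p∣≤0
  matching-large (suc n) p ∣p∣≤1+n with nonempty? p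
  ... | no empty      = ≤-reflexive (trans (cong ∣_∣ (Empty-unique empty)) (∣⊥∣≡0 m))
  ... | yes (x , x∈p) = begin
    ∣ p ∣                                 ≤⟨ ∣p∣≤1+∣p-x∣ p x ⟩
    1 + ∣ p - x ∣                         ≤⟨ s≤s (∣p∣≤1+∣p-x∣ (p - x) (f x)) ⟩
    2 + ∣ p - x - f x ∣                   ≤⟨ s≤s (s≤s (∣p∣≤1+∣p-x∣ (p - x - f x) (h x))) ⟩
    3 + ∣ p′ ∣                            ≤⟨ +-monoʳ-≤ 3 (matching-large n p′ ∣p′∣≤n) ⟩
    3 + length (matching n p′) * 3        ∎
    where
    open ≤-Reasoning
    p′ = p - x - f x - h x
    ∣p′∣≤n : ∣ p′ ∣ ≤ n
    ∣p′∣≤n = s≤s⁻¹ (≤-<-trans (≤-trans (∣p─q∣≤∣p∣ (p - x - f x) ⁅ h x ⁆) (∣p─q∣≤∣p∣ (p - x) ⁅ f x ⁆))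
                              (<-≤-trans (x∈p⇒∣p-x∣<∣p∣ x∈p) ∣p∣≤1+n))

  large-matching : ∃[ xs ] AllPairs Disjoint (map < f , id > xs) × m ≤ length xs * 3
  large-matching = matching m ⊤
                 , AllPairs.map⁺ (matching-disjoint m ⊤)
                 , subst (_≤ length (matching m ⊤) * 3) (∣⊤∣≡n m)
                         (matching-large m ⊤ (≤-reflexive (∣⊤∣≡n m)))

Covers : ∀ {m} → (Fin m → Fin m → Fin m) → Subset m → Set
Covers _⋆_ S = ∀ g → ∃[ x ] ∃[ y ] (x ∈ S × y ∈ S × g ≡ x ⋆ y)

any-false : ∀ {A : Set} (p : A → Bool) {xs x} → any p xs ≡ false → x ∈ₗ xs → p x ≡ false
any-false p none (here refl) = ∨-conicalˡ _ _ none
any-false p none (there x∈) = any-false p (∨-conicalʳ _ _ none) x∈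

pairFree-graph : ∀ {m} (f : Fin m → Fin m) xs S → pairFree (map < f , id > xs) S ≡ false →
                 ∃[ x ] lookup S (f x) ≡ true × lookup S x ≡ true
pairFree-graph f (x ∷ xs) S notFree with bothIn S (f x , x) in both
... | true  = x , ∧-conicalˡ _ _ both , ∧-conicalʳ _ _ both
... | false = pairFree-graph f xs S notFree

module Covering {m} (_⋆_ : Fin m → Fin m → Fin m) (f h : Fin m → Fin m → Fin m)
                (f-⋆ : ∀ g x → f g x ⋆ x ≡ g) (h∘f : ∀ g x → h g (f g x) ≡ x) where

  private
    matchingFor : ∀ g → ∃[ xs ] AllPairs Disjoint (map < f g , id > xs) × m ≤ length xs * 3
    matchingFor g = GraphMatching.large-matching (f g) (h g) (h∘f g)

    pairsFor : Fin m → List (Fin m × Fin m)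
    pairsFor g = map < f g , id > (proj₁ (matchingFor g))

  -- Only the pairs of one matching per g are tested: an over-approximation of "S ⋆ S ≠ G" whose
  -- count is a product of independent factors.
  uncovered : Subset m → Bool
  uncovered S = any (λ g → pairFree (pairsFor g) S) (allFin m)

  covers : ∀ S → uncovered S ≡ false → Covers _⋆_ S
  covers S none g with pairFree-graph (f g) (proj₁ (matchingFor g)) S (any-false _ none (∈-allFin g))
  ... | x , fx∈S , x∈S = f g x , x , lookup⇒[]= (f g x) S fx∈S , lookup⇒[]= x S x∈S , sym (f-⋆ g x)

  countSubsets-uncovered : ∀ t → t * 3 ≤ m → countSubsets m uncovered * 4 ^ t ≤ m * (3 ^ t * 2 ^ m)
  countSubsets-uncovered t t*3≤m =
    subst (countSubsets m uncovered * 4 ^ t ≤_) (cong (_* (3 ^ t * 2 ^ m)) (length-tabulate {n = m} id))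
          (countSubsets-any (pairFree ∘ pairsFor) (allFin m) λ g →
            countSubsets-pairFree t (pairsFor g) (proj₁ (proj₂ (matchingFor g))) (long-enough g))
    where
    long-enough : ∀ g → t ≤ length (pairsFor g)
    long-enough g = subst (t ≤_) (sym (length-map < f g , id > (proj₁ (matchingFor g))))
                          (*-cancelʳ-≤ t _ 3 (≤-trans t*3≤m (proj₂ (proj₂ (matchingFor g)))))

module _ {M} (G : FinGroup M) where
  open FinGroup G
  open IsGroup isGroup using (_//_; _\\_)

  private
    group : Group 0ℓ 0ℓ
    group = record { isGroup = isGroup }

  open GroupProperties group using (\\-leftDividesʳ; //-rightDividesˡ; //-rightDividesʳ)

  private
    sumPartner sumPartner⁻¹ diffPartner diffPartner⁻¹ : Fin M → Fin M → Fin M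
    sumPartner    g x = g // x
    sumPartner⁻¹  g y = y \\ g
    diffPartner   g x = g +ᴳ x
    diffPartner⁻¹ g y = g \\ y

    sumPartner-+ᴳ : ∀ g x → sumPartner g x +ᴳ x ≡ g
    sumPartner-+ᴳ g x = //-rightDividesˡ x g

    diffPartner-// : ∀ g x → diffPartner g x // x ≡ g
    diffPartner-// g x = //-rightDividesʳ x g

    sumPartner⁻¹∘sumPartner : ∀ g x → sumPartner⁻¹ g (sumPartner g x) ≡ x
    sumPartner⁻¹∘sumPartner g x = begin
      (g // x) \\ g                ≡⟨ cong ((g // x) \\_) (sym (//-rightDividesˡ x g)) ⟩
      (g // x) \\ ((g // x) +ᴳ x)  ≡⟨ \\-leftDividesʳ (g // x) x ⟩
      x                            ∎
      where open ≡-Reasoning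

    diffPartner⁻¹∘diffPartner : ∀ g x → diffPartner⁻¹ g (diffPartner g x) ≡ x
    diffPartner⁻¹∘diffPartner = \\-leftDividesʳ

  module SumSet  = Covering _+ᴳ_ sumPartner sumPartner⁻¹ sumPartner-+ᴳ sumPartner⁻¹∘sumPartner
  module DiffSet = Covering _//_ diffPartner diffPartner⁻¹ diffPartner-// diffPartner⁻¹∘diffPartner

  eventFails : Subset M → Bool
  eventFails S = SumSet.uncovered S ∨ DiffSet.uncovered S

  eventFails≡false⇒Event : ∀ S → eventFails S ≡ false → Event G S
  eventFails≡false⇒Event S none = SumSet.covers S (∨-conicalˡ _ _ none) , DiffSet.covers S (∨-conicalʳ _ _ none)

  countSubsets-eventFails : ∀ t → t * 3 ≤ M → countSubsets M eventFails * 4 ^ t ≤ 2 * (M * (3 ^ t * 2 ^ M))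
  countSubsets-eventFails t t*3≤M = begin
    countSubsets M eventFails * 4 ^ t
      ≤⟨ *-monoˡ-≤ (4 ^ t) (countSubsets-∨ SumSet.uncovered DiffSet.uncovered) ⟩
    (countSubsets M SumSet.uncovered + countSubsets M DiffSet.uncovered) * 4 ^ t
      ≡⟨ *-distribʳ-+ (4 ^ t) (countSubsets M SumSet.uncovered) _ ⟩
    countSubsets M SumSet.uncovered * 4 ^ t + countSubsets M DiffSet.uncovered * 4 ^ t
      ≤⟨ +-mono-≤ (SumSet.countSubsets-uncovered t t*3≤M) (DiffSet.countSubsets-uncovered t t*3≤M) ⟩
    M * (3 ^ t * 2 ^ M) + M * (3 ^ t * 2 ^ M)
      ≡⟨ cong (M * (3 ^ t * 2 ^ M) +_) (sym (+-identityʳ _)) ⟩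
    2 * (M * (3 ^ t * 2 ^ M)) ∎
    where open ≤-Reasoning

-- badCount negates Event? with a function local to Defs, which cannot be named here; the hole in
-- the type of bad⇒R is that predicate, solved from its use in badCount-≤.
mutual
  badCount-≤ : ∀ {m} (G : FinGroup m) (R : Subset m → Bool) →
               (∀ S → R S ≡ false → Event G S) → badCount G ≤ countSubsets m R
  badCount-≤ G R event = countSubsets-mono (bad⇒R G R event)

  private
    bad⇒R : ∀ {m} (G : FinGroup m) (R : Subset m → Bool) →
            (∀ S → R S ≡ false → Event G S) → ∀ S → _ ≡ true → R S ≡ true
    bad⇒R G R event S bad with R S in R≡
    ... | true  = refl
    ... | false with does (Event? G S) | dec-true (Event? G S) (event S R≡)
    bad⇒R G R event S () | false | true | refl

Dominated : ℕ → ℕ → ℕ → Set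
Dominated c K t = c * (suc t * 3 ^ t) ≤ K * 4 ^ t

dominated-step : ∀ {c K t} → 2 ≤ t → Dominated c K t → Dominated c K (suc t)
dominated-step {c} {K} {suc (suc u)} (s≤s (s≤s z≤n)) dominated = begin
  c * ((4 + u) * (3 * X))                      ≤⟨ m≤m+n _ (c * (u * X)) ⟩
  c * ((4 + u) * (3 * X)) + c * (u * X)        ≡⟨ slack c u X ⟩
  4 * (c * ((3 + u) * X))                      ≤⟨ *-monoʳ-≤ 4 dominated ⟩
  4 * (K * Y)                                  ≡⟨ swap K Y ⟩
  K * (4 * Y)                                  ∎
  where
  open ≤-Reasoning
  X = 3 ^ (2 + u)
  Y = 4 ^ (2 + u)
  slack : ∀ a u z → a * ((4 + u) * (3 * z)) + a * (u * z) ≡ 4 * (a * ((3 + u) * z))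
  slack = solve-∀
  swap : ∀ a z → 4 * (a * z) ≡ a * (4 * z)
  swap = solve-∀

dominated-1-2 : ∀ t → Dominated 1 2 t
dominated-1-2 0                   = ≤ᵇ⇒≤ 1 2 _
dominated-1-2 1                   = ≤ᵇ⇒≤ 6 8 _
dominated-1-2 2                   = ≤ᵇ⇒≤ 27 32 _
dominated-1-2 (suc (suc (suc u))) =
  dominated-step {1} {2} {2 + u} (s≤s (s≤s z≤n)) (dominated-1-2 (suc (suc u)))

-- Squaring (1 + s) 3^s ≤ 2·4^s gains a second factor 1 + s, which absorbs c.
dominated-double : ∀ c s → 8 * c ≤ s → Dominated c 1 (s + s)
dominated-double c s 8c≤s = *-cancelˡ-≤ (suc s) (begin
  suc s * (c * (suc (s + s) * 3 ^ (s + s)))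
    ≤⟨ *-monoʳ-≤ (suc s) (*-monoʳ-≤ c (*-mono-≤ 1+2s≤2[1+s] (≤-reflexive (^-distribˡ-+-* 3 s s)))) ⟩
  suc s * (c * (2 * suc s * (3 ^ s * 3 ^ s)))
    ≡⟨ square c s (3 ^ s) ⟩
  2 * c * (1 * (suc s * 3 ^ s) * (1 * (suc s * 3 ^ s)))
    ≤⟨ *-monoʳ-≤ (2 * c) (*-mono-≤ (dominated-1-2 s) (dominated-1-2 s)) ⟩
  2 * c * (2 * 4 ^ s * (2 * 4 ^ s))
    ≡⟨ eight c (4 ^ s) ⟩
  8 * c * (4 ^ s * 4 ^ s)
    ≤⟨ *-monoˡ-≤ (4 ^ s * 4 ^ s) (m≤n⇒m≤1+n 8c≤s) ⟩
  suc s * (4 ^ s * 4 ^ s)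
    ≡⟨ cong (suc s *_) (trans (sym (^-distribˡ-+-* 4 s s)) (sym (*-identityˡ _))) ⟩
  suc s * (1 * 4 ^ (s + s))
    ∎)
  where
  open ≤-Reasoning
  double : ∀ a → 2 + (a + a) ≡ 2 * (1 + a)
  double = solve-∀
  1+2s≤2[1+s] : suc (s + s) ≤ 2 * suc s
  1+2s≤2[1+s] = ≤-trans (n≤1+n _) (≤-reflexive (double s))
  square : ∀ a b z → (1 + b) * (a * (2 * (1 + b) * (z * z))) ≡ 2 * a * (1 * ((1 + b) * z) * (1 * ((1 + b) * z)))
  square = solve-∀
  eight : ∀ a z → 2 * a * (2 * z * (2 * z)) ≡ 8 * a * (z * z)
  eight = solve-∀

dominated-eventually : ∀ c → ∃[ T ] (∀ t → T ≤ t → c * (suc t * 3 ^ t) ≤ 4 ^ t)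
dominated-eventually c = T , λ t T≤t → ≤-trans (from (≤⇒≤′ T≤t)) (≤-reflexive (*-identityˡ (4 ^ t)))
  where
  s = suc (8 * c)
  T = s + s
  2≤T : 2 ≤ T
  2≤T = +-mono-≤ (s≤s z≤n) (s≤s z≤n)
  from : ∀ {t} → T ≤′ t → Dominated c 1 t
  from ≤′-refl            = dominated-double c s (n≤1+n (8 * c))
  from (≤′-step {t} T≤′t) = dominated-step {c} {1} {t} (≤-trans 2≤T (≤′⇒≤ T≤′t)) (from T≤′t)

c*badCount≤2^M : ∀ {M} (G : FinGroup M) c T → (∀ t → T ≤ t → 6 * c * (suc t * 3 ^ t) ≤ 4 ^ t) →
                 T * 3 ≤ M → c * badCount G ≤ 2 ^ M
c*badCount≤2^M {M} G c T decay T*3≤M = *-cancelʳ-≤ (c * badCount G) (2 ^ M) (4 ^ t) {{m^n≢0 4 t}} (begin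
  c * badCount G * 4 ^ t                       ≡⟨ *-assoc c (badCount G) (4 ^ t) ⟩
  c * (badCount G * 4 ^ t)                     ≤⟨ *-monoʳ-≤ c (*-monoˡ-≤ (4 ^ t) (badCount-≤ G (eventFails G) (eventFails≡false⇒Event G))) ⟩
  c * (countSubsets M (eventFails G) * 4 ^ t)  ≤⟨ *-monoʳ-≤ c (countSubsets-eventFails G t (m/n*n≤m M 3)) ⟩
  c * (2 * (M * X))                            ≤⟨ *-monoʳ-≤ c (*-monoʳ-≤ 2 (*-monoˡ-≤ X (<⇒≤ M<[1+t]*3))) ⟩
  c * (2 * (suc t * 3 * X))                    ≡⟨ regroup c (suc t) (3 ^ t) (2 ^ M) ⟩
  6 * c * (suc t * 3 ^ t) * 2 ^ M              ≤⟨ *-monoˡ-≤ (2 ^ M) (decay t T≤t) ⟩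
  4 ^ t * 2 ^ M                                ≡⟨ *-comm (4 ^ t) (2 ^ M) ⟩
  2 ^ M * 4 ^ t                                ∎)
  where
  open ≤-Reasoning
  t = M / 3
  X = 3 ^ t * 2 ^ M
  M<[1+t]*3 : M < suc t * 3
  M<[1+t]*3 = subst (_< suc t * 3) (sym (m≡m%n+[m/n]*n M 3)) (+-monoˡ-< (t * 3) (m%n<n M 3))
  T≤t : T ≤ t
  T≤t = subst (_≤ t) (m*n/n≡m T 3) (/-monoˡ-≤ 3 T*3≤M)
  regroup : ∀ a b y z → a * (2 * (b * 3 * (y * z))) ≡ 6 * a * (b * y) * z
  regroup = solve-∀

theorem1 : (m : ℕ → ℕ) → (G : (n : ℕ) → FinGroup (m n))
    → (∀ B → ∃[ N ] (∀ n → N ≤ n → B ≤ m n))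
    → ∀ k → ∃[ N ] (∀ n → N ≤ n → suc k * badCount (G n) ≤ 2 ^ m n)
theorem1 m G unbounded k with dominated-eventually (6 * suc k)
... | T , decay with unbounded (T * 3)
... | N , large = N , λ n N≤n → c*badCount≤2^M (G n) (suc k) T decay (large n N≤n)
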